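{- For every positive integer $n$, there is a bijection $\phi$ from the set of set partitions of $[n]=\{1,2,\ldots,n\}$ to itself such that, for every partition $\pi$ of $[n]$, the number of singletons of $\phi(\pi)$ equals the number of adjacencies of $\pi$, and the number of adjacencies of $\phi(\pi)$ equals the number of singletons of $\pi$.
   Context: A partition of $[n]$ is a set of nonempty, pairwise disjoint blocks whose union is $[n]$. A singleton is a block with exactly one element. An adjacency is a pair of cyclically consecutive elements of $[n]$, i.e. $(i,i+1)$ for $1\le i\le n-1$ or $(n,1)$, whose two elements lie in the same block. (For $n=1$, the element $1$ is considered to form an adjacency with itself.) -}

module Defs where

open import Data.Nat using (ℕ; zero; suc)
open import Data.Fin using (Fin; zero; suc; toℕ; lower₁; _≟_)
open import Data.Fin.Properties using (all?)
open import Data.List using (List; length; filter)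
open import Data.List using () renaming (allFin to finList)
open import Data.Nat.Properties using () renaming (_≟_ to _≟ℕ_)
open import Relation.Binary.PropositionalEquality using (_≡_)
open import Relation.Nullary using (yes; no; ¬_; Dec)
open import Relation.Nullary.Decidable using (¬?; _→-dec_)
open import Data.Product using (_×_)
open import Function.Bundles using (_⇔_)

-- A set partition of [n] = Fin n is presented by a block-labelling
-- function: i and j lie in the same block iff they get the same label.
-- Every partition arises this way, and two labellings present the same
-- partition iff they induce the same "same block" relation (_≈P_ below).
-- Hence the set of partitions of [n] is the setoid (Partition n, _≈P_).
record Partition (n : ℕ) : Set where
  constructor mkPartition
  field
    label : Fin n → Fin n

open Partition public

SameBlock : ∀ {n} → Partition n → Fin n → Fin n → Set
SameBlock π i j = label π i ≡ label π j

sameBlock? : ∀ {n} (π : Partition n) (i j : Fin n) → Dec (SameBlock π i j)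
sameBlock? π i j = label π i ≟ label π j

_≈P_ : ∀ {n} → Partition n → Partition n → Set
π ≈P σ = ∀ i j → SameBlock π i j ⇔ SameBlock σ i j

-- cyclic successor on [n]: i ↦ i+1, and n ↦ 1 (for n = 1, 1 ↦ 1)
next : ∀ {n} → Fin n → Fin n
next {suc m} i with m ≟ℕ toℕ i
... | yes _ = zero
... | no ne = suc (lower₁ i ne)

IsSingleton : ∀ {n} → Partition n → Fin n → Set
IsSingleton π i = ∀ j → SameBlock π i j → i ≡ j

isSingleton? : ∀ {n} (π : Partition n) (i : Fin n) → Dec (IsSingleton π i)
isSingleton? π i = all? (λ j → sameBlock? π i j →-dec (i ≟ j))

singletons : ∀ {n} → Partition n → ℕ
singletons {n} π = length (filter (isSingleton? π) (finList n))

adjacencies : ∀ {n} → Partition n → ℕ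
adjacencies {n} π = length (filter (λ i → sameBlock? π i (next i)) (finList n))

-- Partitions are handled as labellings Fin n → ℕ up to renaming of labels (_≈_), and the bijection
-- φ satisfies the positionwise relation π ⇄ φ π: i+1 is a singleton of π iff (i, i+1) is an
-- adjacency of φ π, and (i, i+1) is an adjacency of π iff i is a singleton of φ π. Counting
-- positions then gives both equalities.
--
-- For n ≥ 2, φ takes the first pivot i of π, an element that is a singleton or adjacent to its
-- successor, and rotates the cycle so that i becomes the last element. A singleton is deleted,
-- φ is applied recursively, and it is put back into the block of its predecessor; an element in
-- the block of its successor 1 is deleted and put back as a singleton. Without pivots π has
-- neither singletons nor adjacencies and is fixed. The inverse distinguishes the two cases by
-- whether the last element is adjacent to its predecessor. It rotates at the same position i,
-- since π ⇄ φ π makes i a pivot of π iff in φ π it is a singleton or adjacent to its predecessor.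

module Submission where

open import Defs
open import Data.Bool using (true; false; if_then_else_)
open import Data.Empty using (⊥-elim)
open import Data.Fin using (Fin; zero; suc; toℕ; fromℕ; inject₁; _≟_)
open import Data.Fin.Properties
  using (all?; toℕ-injective; toℕ-inject₁; toℕ<n; toℕ-fromℕ; lower₁-inject₁′; fromℕ≢inject₁; inject₁-injective;
         0≢1+n)
open import Data.Fin.Relation.Unary.Top using (view; ‵fromℕ; ‵inject₁; view-inject₁; view-fromℕ)
open import Data.List using ([]; _∷_; length; filter; map; tabulate; allFin)
import Data.List as List
open import Data.List.Extrema.Nat using (max; xs≤max)
open import Data.List.Properties using (filter-≐; map-tabulate; tabulate-cong)
open import Data.List.Relation.Binary.Permutation.Propositional using (_↭_; ↭-refl; ↭-sym; ↭-reflexive; ↭-trans)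
open import Data.List.Relation.Binary.Permutation.Propositional.Properties using (↭-length; filter-↭; ∷↭∷ʳ)
open import Data.List.Relation.Unary.All.Properties using (tabulate⁻)
open import Data.Maybe using (Maybe; just; nothing; fromMaybe)
import Data.Maybe as Maybe
open import Data.Maybe.Properties using (just-injective)
open import Data.Nat using (ℕ; zero; suc; _<_; s≤s)
open import Data.Nat.GeneralisedArithmetic using (iterate; fold)
open import Data.Nat.Properties using (<-irrefl; <⇒≢) renaming (_≟_ to _≟ℕ_)
open import Data.Product using (Σ; _×_; _,_)
open import Data.Sum using (_⊎_; inj₁; inj₂)
open import Data.Sum.Function.Propositional using (_⊎-cong_)
open import Data.Vec.Functional using (init; last)
open import Function using (_∘_; id; Injective)
open import Function.Bundles using (_⇔_; mk⇔; Equivalence)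
open import Function.Properties.Equivalence using (⇔-isEquivalence; ⇔-setoid)
open import Level using (0ℓ)
open import Relation.Binary.PropositionalEquality
import Relation.Binary.Reasoning.Setoid
open import Relation.Binary.Bundles using (Setoid)
open import Relation.Binary.Structures using (IsEquivalence)
open import Relation.Nullary using (¬_; yes; no; does)
open import Relation.Nullary.Decidable using (does-⇔; _→-dec_; _⊎-dec_)
open import Relation.Unary using (Pred; Decidable)

open Equivalence using (to; from)
open IsEquivalence (⇔-isEquivalence {0ℓ}) using () renaming (refl to ⇔-refl; sym to ⇔-sym; trans to ⇔-trans)
module ⇔-Reasoning = Relation.Binary.Reasoning.Setoid (⇔-setoid 0ℓ)

private variable
  A B C D : Set
  n : ℕ

both : {P Q : Set} → P → Q → P ⇔ Q
both p q = mk⇔ (λ _ → q) (λ _ → p)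

neither : {P Q : Set} → ¬ P → ¬ Q → P ⇔ Q
neither ¬p ¬q = mk⇔ (⊥-elim ∘ ¬p) (⊥-elim ∘ ¬q)

≡-comm-⇔ : {x y : A} → (x ≡ y) ⇔ (y ≡ x)
≡-comm-⇔ = mk⇔ sym sym

-- The cycle 1 → 2 → ⋯ → n → 1 and its rotations

next-inject₁ : ∀ {m} (i : Fin m) → next (inject₁ i) ≡ suc i
next-inject₁ {m} i with m ≟ℕ toℕ (inject₁ i)
... | yes m≡i = ⊥-elim (<-irrefl (sym (trans m≡i (toℕ-inject₁ i))) (toℕ<n i))
... | no m≢i  = cong suc (lower₁-inject₁′ i m≢i)

next-fromℕ : ∀ m → next (fromℕ m) ≡ zero
next-fromℕ m with m ≟ℕ toℕ (fromℕ m)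
... | yes _   = refl
... | no m≢m = ⊥-elim (m≢m (sym (toℕ-fromℕ m)))

prev : ∀ {m} → Fin (suc m) → Fin (suc m)
prev {m} zero = fromℕ m
prev (suc i) = inject₁ i

next-prev : ∀ {m} (i : Fin (suc m)) → next (prev i) ≡ i
next-prev {m} zero = next-fromℕ m
next-prev (suc i) = next-inject₁ i

prev-next : ∀ {m} (i : Fin (suc m)) → prev (next i) ≡ i
prev-next i with view i
... | ‵fromℕ     = cong prev (next-fromℕ _)
... | ‵inject₁ j = cong prev (next-inject₁ j)

record CycleAutomorphism (n : ℕ) : Set where
  field
    apply unapply : Fin n → Fin n
    apply-unapply : ∀ i → apply (unapply i) ≡ i
    unapply-apply : ∀ i → unapply (apply i) ≡ i
    apply-next : ∀ i → apply (next i) ≡ next (apply i)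

  unapply-next : ∀ i → unapply (next i) ≡ next (unapply i)
  unapply-next i = begin
    unapply (next i)                    ≡⟨ cong (λ j → unapply (next j)) (apply-unapply i) ⟨
    unapply (next (apply (unapply i)))  ≡⟨ cong unapply (apply-next (unapply i)) ⟨
    unapply (apply (next (unapply i)))  ≡⟨ unapply-apply (next (unapply i)) ⟩
    next (unapply i)                    ∎
    where open ≡-Reasoning

open CycleAutomorphism

inverse : CycleAutomorphism n → CycleAutomorphism n
inverse ρ = record
  { apply = unapply ρ
  ; unapply = apply ρ
  ; apply-unapply = unapply-apply ρ
  ; unapply-apply = apply-unapply ρ
  ; apply-next = unapply-next ρ
  }

apply-prev : ∀ {m} (ρ : CycleAutomorphism (suc m)) (i : Fin (suc m)) → apply ρ (prev i) ≡ prev (apply ρ i)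
apply-prev ρ i = begin
  apply ρ (prev i)                 ≡⟨ prev-next (apply ρ (prev i)) ⟨
  prev (next (apply ρ (prev i)))   ≡⟨ cong prev (apply-next ρ (prev i)) ⟨
  prev (apply ρ (next (prev i)))   ≡⟨ cong (λ j → prev (apply ρ j)) (next-prev i) ⟩
  prev (apply ρ i)                 ∎
  where open ≡-Reasoning

rotation : ∀ {m} → ℕ → CycleAutomorphism (suc m)
rotation k = record
  { apply = λ i → iterate next i k
  ; unapply = λ i → fold i prev k
  ; apply-unapply = iterate-fold k
  ; unapply-apply = fold-iterate k
  ; apply-next = iterate-next k
  }
  where
  iterate-next : ∀ k i → iterate next (next i) k ≡ next (iterate next i k)
  iterate-next zero    i = refl
  iterate-next (suc k) i = iterate-next k (next i)
  iterate-fold : ∀ k i → iterate next (fold i prev k) k ≡ i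
  iterate-fold zero    i = refl
  iterate-fold (suc k) i = trans (cong (λ j → iterate next j k) (next-prev _)) (iterate-fold k i)
  fold-iterate : ∀ k i → fold (iterate next i k) prev k ≡ i
  fold-iterate zero    i = refl
  fold-iterate (suc k) i = trans (cong prev (fold-iterate k (next i))) (prev-next i)

rotation-fromℕ : ∀ {m} k (i : Fin (suc m)) → toℕ i ≡ k → apply (rotation (suc k)) (fromℕ m) ≡ i
rotation-fromℕ {m} zero    zero    _    = next-fromℕ m
rotation-fromℕ {m} (suc k) (suc j) refl = begin
  apply (rotation (suc (suc k))) (fromℕ m)   ≡⟨ apply-next (rotation (suc k)) (fromℕ m) ⟩
  next (apply (rotation (suc k)) (fromℕ m))  ≡⟨ cong next (rotation-fromℕ k (inject₁ j) (toℕ-inject₁ j)) ⟩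
  next (inject₁ j)                           ≡⟨ next-inject₁ j ⟩
  suc j                                      ∎
  where open ≡-Reasoning

rotationTo : ∀ {m} → Fin (suc m) → CycleAutomorphism (suc m)
rotationTo i = rotation (suc (toℕ i))

rotationTo-fromℕ : ∀ {m} (i : Fin (suc m)) → apply (rotationTo i) (fromℕ m) ≡ i
rotationTo-fromℕ i = rotation-fromℕ (toℕ i) i refl

-- Labellings

infix 4 _≈_ _⇄_

_≈_ : (Fin n → A) → (Fin n → B) → Set
f ≈ g = ∀ i j → (f i ≡ f j) ⇔ (g i ≡ g j)

≈-refl : {f : Fin n → A} → f ≈ f
≈-refl i j = ⇔-refl

≈-sym : {f : Fin n → A} {g : Fin n → B} → f ≈ g → g ≈ f
≈-sym f≈g i j = ⇔-sym (f≈g i j)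

≈-trans : {f : Fin n → A} {g : Fin n → B} {h : Fin n → C} → f ≈ g → g ≈ h → f ≈ h
≈-trans f≈g g≈h i j = ⇔-trans (f≈g i j) (g≈h i j)

≗⇒≈ : {f g : Fin n → A} → (∀ i → f i ≡ g i) → f ≈ g
≗⇒≈ f≗g i j = mk⇔ (λ e → trans (sym (f≗g i)) (trans e (f≗g j)))
                   (λ e → trans (f≗g i) (trans e (sym (f≗g j))))

∘-≈ : ∀ {m} {f : Fin n → A} {g : Fin n → B} (r : Fin m → Fin n) → f ≈ g → f ∘ r ≈ g ∘ r
∘-≈ r f≈g i j = f≈g (r i) (r j)

injective-≈ : {c : A → B} → Injective _≡_ _≡_ c → (f : Fin n → A) → c ∘ f ≈ f
injective-≈ {c = c} c-inj f i j = mk⇔ c-inj (cong c)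

Labelling : ℕ → Set
Labelling n = Fin n → ℕ

Preserves-≈ : (Labelling n → Labelling n) → Set
Preserves-≈ F = ∀ {f g} → f ≈ g → F f ≈ F g

≈-setoid : ℕ → Setoid 0ℓ 0ℓ
≈-setoid n = record
  { Carrier = Labelling n
  ; _≈_ = _≈_
  ; isEquivalence = record { refl = ≈-refl ; sym = ≈-sym ; trans = ≈-trans }
  }

module ≈-Reasoning {n} = Relation.Binary.Reasoning.Setoid (≈-setoid n)

Singleton : (Fin n → A) → Fin n → Set
Singleton f i = ∀ j → f i ≡ f j → i ≡ j

Adjacent : (Fin n → A) → Fin n → Set
Adjacent f i = f i ≡ f (next i)

Singleton? : (f : Labelling n) → Decidable (Singleton f)
Singleton? f i = all? (λ j → (f i ≟ℕ f j) →-dec (i ≟ j))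

Adjacent? : (f : Labelling n) → Decidable (Adjacent f)
Adjacent? f i = f i ≟ℕ f (next i)

record _⇄_ (f : Fin n → A) (g : Fin n → B) : Set where
  field
    singleton⇔adjacent : ∀ i → Singleton f (next i) ⇔ Adjacent g i
    adjacent⇔singleton : ∀ i → Adjacent f i ⇔ Singleton g i

open _⇄_ public

Singleton-≈ : {f : Fin n → A} {g : Fin n → B} → f ≈ g → ∀ i → Singleton f i ⇔ Singleton g i
Singleton-≈ f≈g i = mk⇔ (λ s j e → s j (from (f≈g i j) e)) (λ s j e → s j (to (f≈g i j) e))

Adjacent-≈ : {f : Fin n → A} {g : Fin n → B} → f ≈ g → ∀ i → Adjacent f i ⇔ Adjacent g i
Adjacent-≈ f≈g i = f≈g i (next i)

⇄-≈ : {f : Fin n → A} {f′ : Fin n → B} {g : Fin n → C} {g′ : Fin n → D} →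
      f ≈ f′ → g ≈ g′ → f ⇄ g → f′ ⇄ g′
⇄-≈ f≈f′ g≈g′ f⇄g = record
  { singleton⇔adjacent = λ i → ⇔-trans (Singleton-≈ (≈-sym f≈f′) (next i))
                                 (⇔-trans (singleton⇔adjacent f⇄g i) (Adjacent-≈ g≈g′ i))
  ; adjacent⇔singleton = λ i → ⇔-trans (Adjacent-≈ (≈-sym f≈f′) i)
                                 (⇔-trans (adjacent⇔singleton f⇄g i) (Singleton-≈ g≈g′ i))
  }

module _ (ρ : CycleAutomorphism n) where

  Singleton-∘ : (f : Fin n → A) → ∀ i → Singleton (f ∘ apply ρ) i ⇔ Singleton f (apply ρ i)
  Singleton-∘ f i = mk⇔
    (λ s j e → trans (cong (apply ρ) (s (unapply ρ j) (trans e (cong f (sym (apply-unapply ρ j))))))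
                     (apply-unapply ρ j))
    (λ s j e → trans (sym (unapply-apply ρ i)) (trans (cong (unapply ρ) (s (apply ρ j) e)) (unapply-apply ρ j)))

  Adjacent-∘ : (f : Fin n → A) → ∀ i → Adjacent (f ∘ apply ρ) i ⇔ Adjacent f (apply ρ i)
  Adjacent-∘ f i = mk⇔ (λ e → trans e (cong f (apply-next ρ i))) (λ e → trans e (cong f (sym (apply-next ρ i))))

  ⇄-∘ : {f : Fin n → A} {g : Fin n → B} → f ⇄ g → f ∘ apply ρ ⇄ g ∘ apply ρ
  ⇄-∘ {f = f} {g} f⇄g = record
    { singleton⇔adjacent = λ i → begin
        Singleton (f ∘ apply ρ) (next i)  ≈⟨ Singleton-∘ f (next i) ⟩
        Singleton f (apply ρ (next i))    ≡⟨ cong (Singleton f) (apply-next ρ i) ⟩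
        Singleton f (next (apply ρ i))    ≈⟨ singleton⇔adjacent f⇄g (apply ρ i) ⟩
        Adjacent g (apply ρ i)            ≈⟨ Adjacent-∘ g i ⟨
        Adjacent (g ∘ apply ρ) i          ∎
    ; adjacent⇔singleton = λ i → begin
        Adjacent (f ∘ apply ρ) i   ≈⟨ Adjacent-∘ f i ⟩
        Adjacent f (apply ρ i)     ≈⟨ adjacent⇔singleton f⇄g (apply ρ i) ⟩
        Singleton g (apply ρ i)    ≈⟨ Singleton-∘ g i ⟨
        Singleton (g ∘ apply ρ) i  ∎
    }
    where open ⇔-Reasoning

first : {P : Pred (Fin n) 0ℓ} → Decidable P → Maybe (Fin n)
first {zero}  P? = nothing
first {suc n} P? = if does (P? zero) then just zero else Maybe.map suc (first (P? ∘ suc))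

first-just : ∀ {n} {P : Pred (Fin n) 0ℓ} (P? : Decidable P) {i : Fin n} → first P? ≡ just i → P i
first-just {suc n} P? eq with P? zero | first (P? ∘ suc) in eq′
first-just {suc n} P? refl | yes p | _      = p
first-just {suc n} P? refl | no _  | just i = first-just (P? ∘ suc) eq′

first-nothing : ∀ {n} {P : Pred (Fin n) 0ℓ} (P? : Decidable P) → first P? ≡ nothing → ∀ i → ¬ P i
first-nothing {suc n} P? eq i with P? zero | first (P? ∘ suc) in eq′
first-nothing {suc n} P? refl zero    | no ¬p | nothing = ¬p
first-nothing {suc n} P? refl (suc i) | no _  | nothing = first-nothing (P? ∘ suc) eq′ i

first-cong : ∀ {n} {P Q : Pred (Fin n) 0ℓ} (P? : Decidable P) (Q? : Decidable Q) →
             (∀ i → P i ⇔ Q i) → first P? ≡ first Q?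
first-cong {zero}  P? Q? P⇔Q = refl
first-cong {suc n} P? Q? P⇔Q = cong₂ (λ b r → if b then just zero else Maybe.map suc r)
  (does-⇔ (P⇔Q zero) (P? zero) (Q? zero)) (first-cong (P? ∘ suc) (Q? ∘ suc) (P⇔Q ∘ suc))

-- Adding a last element

infixl 5 _∷ʳ_

_∷ʳ_ : (Fin n → A) → A → Fin (suc n) → A
(h ∷ʳ v) i with view i
... | ‵fromℕ     = v
... | ‵inject₁ j = h j

∷ʳ-inject₁ : (h : Fin n → A) (v : A) (j : Fin n) → (h ∷ʳ v) (inject₁ j) ≡ h j
∷ʳ-inject₁ h v j rewrite view-inject₁ j = refl

∷ʳ-fromℕ : (h : Fin n → A) (v : A) → (h ∷ʳ v) (fromℕ n) ≡ v
∷ʳ-fromℕ {n = n} h v rewrite view-fromℕ n = refl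

init-∷ʳ-last : (g : Fin (suc n) → A) → ∀ i → (init g ∷ʳ last g) i ≡ g i
init-∷ʳ-last g i with view i
... | ‵fromℕ     = refl
... | ‵inject₁ j = refl

init-∷ʳ : (h : Fin n → A) (v : A) → init (h ∷ʳ v) ≈ h
init-∷ʳ h v = ≗⇒≈ (∷ʳ-inject₁ h v)

∷ʳ-cong : {h₁ : Fin n → A} {h₂ : Fin n → B} {v₁ : A} {v₂ : B} →
          h₁ ≈ h₂ → (∀ j → (h₁ j ≡ v₁) ⇔ (h₂ j ≡ v₂)) → h₁ ∷ʳ v₁ ≈ h₂ ∷ʳ v₂
∷ʳ-cong h₁≈h₂ same-v i j with view i | view j
... | ‵fromℕ     | ‵fromℕ     = mk⇔ (λ _ → refl) (λ _ → refl)
... | ‵fromℕ     | ‵inject₁ b = ⇔-trans ≡-comm-⇔ (⇔-trans (same-v b) ≡-comm-⇔)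
... | ‵inject₁ a | ‵fromℕ     = same-v a
... | ‵inject₁ a | ‵inject₁ b = h₁≈h₂ a b

fresh : Labelling n → ℕ
fresh h = suc (max 0 (tabulate h))

fresh-∉ : (h : Labelling n) (j : Fin n) → h j ≢ fresh h
fresh-∉ h j = <⇒≢ (s≤s (tabulate⁻ (xs≤max 0 (tabulate h)) j))

joinBlock : Labelling n → Fin n → Labelling (suc n)
joinBlock h x = h ∷ʳ h x

newBlock : Labelling n → Labelling (suc n)
newBlock h = h ∷ʳ fresh h

joinBlock-cong : {h₁ h₂ : Labelling n} → h₁ ≈ h₂ → ∀ x → joinBlock h₁ x ≈ joinBlock h₂ x
joinBlock-cong h₁≈h₂ x = ∷ʳ-cong h₁≈h₂ (λ j → h₁≈h₂ j x)

newBlock-cong : {h₁ h₂ : Labelling n} → h₁ ≈ h₂ → newBlock h₁ ≈ newBlock h₂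
newBlock-cong {h₁ = h₁} {h₂} h₁≈h₂ = ∷ʳ-cong h₁≈h₂ (λ j → neither (fresh-∉ h₁ j) (fresh-∉ h₂ j))

≈-joinBlock-init : (g : Labelling (suc n)) (x : Fin n) → g (inject₁ x) ≡ last g → g ≈ joinBlock (init g) x
≈-joinBlock-init g x gx≡last = ≈-trans (≗⇒≈ (sym ∘ init-∷ʳ-last g))
  (∷ʳ-cong ≈-refl (λ j → mk⇔ (λ e → trans e (sym gx≡last)) (λ e → trans e gx≡last)))

≈-newBlock-init : (g : Labelling (suc n)) → Singleton g (fromℕ n) → g ≈ newBlock (init g)
≈-newBlock-init g last-single = ≈-trans (≗⇒≈ (sym ∘ init-∷ʳ-last g))
  (∷ʳ-cong ≈-refl (λ j → neither (λ e → fromℕ≢inject₁ (last-single _ (sym e))) (fresh-∉ (init g) j)))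

top₂-elim : ∀ {m} {P : Fin (suc (suc m)) → Set} →
            P (fromℕ (suc m)) → P (inject₁ (fromℕ m)) → (∀ k → P (inject₁ (inject₁ k))) → ∀ i → P i
top₂-elim p-last p-penultimate p-inner i with view i
... | ‵fromℕ     = p-last
... | ‵inject₁ j with view j
...   | ‵fromℕ     = p-penultimate
...   | ‵inject₁ k = p-inner k

module _ {m : ℕ} (h : Fin (suc m) → A) (v : A) where

  Singleton-∷ʳ-inject₁ : ∀ j → (Singleton h j → h j ≢ v) → Singleton (h ∷ʳ v) (inject₁ j) ⇔ Singleton h j
  Singleton-∷ʳ-inject₁ j separated = mk⇔
    (λ s k e → inject₁-injective
                 (s (inject₁ k) (trans (∷ʳ-inject₁ h v j) (trans e (sym (∷ʳ-inject₁ h v k))))))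
    (λ s → extend s)
    where
    extend : Singleton h j → Singleton (h ∷ʳ v) (inject₁ j)
    extend s k e with view k
    ... | ‵fromℕ      = ⊥-elim (separated s (trans (sym (∷ʳ-inject₁ h v j)) e))
    ... | ‵inject₁ k′ = cong inject₁ (s k′ (trans (sym (∷ʳ-inject₁ h v j)) e))

  Adjacent-∷ʳ-inner : ∀ k → Adjacent (h ∷ʳ v) (inject₁ (inject₁ k)) ≡ Adjacent h (inject₁ k)
  Adjacent-∷ʳ-inner k = cong₂ _≡_ (∷ʳ-inject₁ h v (inject₁ k)) (begin
    (h ∷ʳ v) (next (inject₁ (inject₁ k)))  ≡⟨ cong (h ∷ʳ v) (next-inject₁ (inject₁ k)) ⟩
    (h ∷ʳ v) (inject₁ (suc k))             ≡⟨ ∷ʳ-inject₁ h v (suc k) ⟩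
    h (suc k)                              ≡⟨ cong h (next-inject₁ k) ⟨
    h (next (inject₁ k))                   ∎)
    where open ≡-Reasoning

  Adjacent-∷ʳ-penultimate : Adjacent (h ∷ʳ v) (inject₁ (fromℕ m)) ≡ (h (fromℕ m) ≡ v)
  Adjacent-∷ʳ-penultimate = cong₂ _≡_ (∷ʳ-inject₁ h v (fromℕ m))
    (trans (cong (h ∷ʳ v) (next-inject₁ (fromℕ m))) (∷ʳ-fromℕ h v))

  Adjacent-∷ʳ-last : Adjacent (h ∷ʳ v) (fromℕ (suc m)) ≡ (v ≡ h zero)
  Adjacent-∷ʳ-last = cong₂ _≡_ (∷ʳ-fromℕ h v) (trans (cong (h ∷ʳ v) (next-fromℕ (suc m))) (∷ʳ-inject₁ h v zero))

Adjacent-fromℕ : ∀ {m} (h : Fin (suc m) → A) → Adjacent h (fromℕ m) ≡ (h (fromℕ m) ≡ h zero)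
Adjacent-fromℕ {m = m} h = cong (λ i → h (fromℕ m) ≡ h i) (next-fromℕ m)

Singleton-newBlock-last : (h : Labelling n) → Singleton (newBlock h) (fromℕ n)
Singleton-newBlock-last {n = n} h j e with view j
... | ‵fromℕ     = refl
... | ‵inject₁ k = ⊥-elim (fresh-∉ h k (sym (trans (sym (∷ʳ-fromℕ h (fresh h))) e)))

module _ (h : Labelling n) (x : Fin n) where

  joinBlock-last : joinBlock h x (fromℕ n) ≡ joinBlock h x (inject₁ x)
  joinBlock-last = trans (∷ʳ-fromℕ h (h x)) (sym (∷ʳ-inject₁ h (h x) x))

  ¬Singleton-joinBlock-last : ¬ Singleton (joinBlock h x) (fromℕ n)
  ¬Singleton-joinBlock-last s = fromℕ≢inject₁ (s (inject₁ x) joinBlock-last)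

  ¬Singleton-joinBlock-inject₁ : ¬ Singleton (joinBlock h x) (inject₁ x)
  ¬Singleton-joinBlock-inject₁ s = fromℕ≢inject₁ (sym (s (fromℕ n) (sym joinBlock-last)))

module _ {m : ℕ} {f h : Labelling (suc m)} (f⇄h : f ⇄ h) (v w : ℕ) where
  open ⇔-Reasoning

  singleton⇔adjacent-inner : (∀ k → Singleton f (suc k) → f (suc k) ≢ v) →
    ∀ k → Singleton (f ∷ʳ v) (next (inject₁ (inject₁ k))) ⇔ Adjacent (h ∷ʳ w) (inject₁ (inject₁ k))
  singleton⇔adjacent-inner separated k = begin
    Singleton (f ∷ʳ v) (next (inject₁ (inject₁ k)))  ≡⟨ cong (Singleton (f ∷ʳ v)) (next-inject₁ (inject₁ k)) ⟩
    Singleton (f ∷ʳ v) (inject₁ (suc k))             ≈⟨ Singleton-∷ʳ-inject₁ f v (suc k) (separated k) ⟩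
    Singleton f (suc k)                              ≡⟨ cong (Singleton f) (next-inject₁ k) ⟨
    Singleton f (next (inject₁ k))                   ≈⟨ singleton⇔adjacent f⇄h (inject₁ k) ⟩
    Adjacent h (inject₁ k)                           ≡⟨ Adjacent-∷ʳ-inner h w k ⟨
    Adjacent (h ∷ʳ w) (inject₁ (inject₁ k))          ∎

  adjacent⇔singleton-inject₁ : ∀ j → (Singleton h j → h j ≢ w) → Adjacent (f ∷ʳ v) (inject₁ j) ≡ Adjacent f j →
    Adjacent (f ∷ʳ v) (inject₁ j) ⇔ Singleton (h ∷ʳ w) (inject₁ j)
  adjacent⇔singleton-inject₁ j separated adjacent-restricts = begin
    Adjacent (f ∷ʳ v) (inject₁ j)   ≡⟨ adjacent-restricts ⟩
    Adjacent f j                    ≈⟨ adjacent⇔singleton f⇄h j ⟩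
    Singleton h j                   ≈⟨ Singleton-∷ʳ-inject₁ h w j separated ⟨
    Singleton (h ∷ʳ w) (inject₁ j)  ∎

module _ {m : ℕ} {f h : Labelling (suc m)} (f⇄h : f ⇄ h) where
  open ⇔-Reasoning

  newBlock⇄joinBlock : newBlock f ⇄ joinBlock h (fromℕ m)
  newBlock⇄joinBlock = record { singleton⇔adjacent = s⇔a ; adjacent⇔singleton = a⇔s }
    where
    F = newBlock f
    H = joinBlock h (fromℕ m)
    s⇔a : ∀ i → Singleton F (next i) ⇔ Adjacent H i
    s⇔a = top₂-elim
      (begin
        Singleton F (next (fromℕ (suc m)))  ≡⟨ cong (Singleton F) (next-fromℕ (suc m)) ⟩
        Singleton F (inject₁ zero)          ≈⟨ Singleton-∷ʳ-inject₁ f (fresh f) zero (λ _ → fresh-∉ f zero) ⟩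
        Singleton f zero                    ≡⟨ cong (Singleton f) (next-fromℕ m) ⟨
        Singleton f (next (fromℕ m))        ≈⟨ singleton⇔adjacent f⇄h (fromℕ m) ⟩
        Adjacent h (fromℕ m)                ≡⟨ Adjacent-fromℕ h ⟩
        (h (fromℕ m) ≡ h zero)              ≡⟨ Adjacent-∷ʳ-last h (h (fromℕ m)) ⟨
        Adjacent H (fromℕ (suc m))          ∎)
      (begin
        Singleton F (next (inject₁ (fromℕ m)))  ≡⟨ cong (Singleton F) (next-inject₁ (fromℕ m)) ⟩
        Singleton F (fromℕ (suc m))             ≈⟨ both (Singleton-newBlock-last f) refl ⟩
        (h (fromℕ m) ≡ h (fromℕ m))             ≡⟨ Adjacent-∷ʳ-penultimate h (h (fromℕ m)) ⟨
        Adjacent H (inject₁ (fromℕ m))          ∎)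
      (singleton⇔adjacent-inner f⇄h _ _ (λ k _ → fresh-∉ f (suc k)))
    a⇔s : ∀ i → Adjacent F i ⇔ Singleton H i
    a⇔s = top₂-elim
      (begin
        Adjacent F (fromℕ (suc m))  ≡⟨ Adjacent-∷ʳ-last f (fresh f) ⟩
        (fresh f ≡ f zero)          ≈⟨ neither (fresh-∉ f zero ∘ sym) (¬Singleton-joinBlock-last h (fromℕ m)) ⟩
        Singleton H (fromℕ (suc m)) ∎)
      (begin
        Adjacent F (inject₁ (fromℕ m))   ≡⟨ Adjacent-∷ʳ-penultimate f (fresh f) ⟩
        (f (fromℕ m) ≡ fresh f)          ≈⟨ neither (fresh-∉ f (fromℕ m)) (¬Singleton-joinBlock-inject₁ h (fromℕ m)) ⟩
        Singleton H (inject₁ (fromℕ m))  ∎)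
      (λ k → adjacent⇔singleton-inject₁ f⇄h _ _ (inject₁ k)
        (λ s e → fromℕ≢inject₁ (sym (s (fromℕ m) e))) (Adjacent-∷ʳ-inner f (fresh f) k))

  joinBlock⇄newBlock : joinBlock f zero ⇄ newBlock h
  joinBlock⇄newBlock = record { singleton⇔adjacent = s⇔a ; adjacent⇔singleton = a⇔s }
    where
    F = joinBlock f zero
    H = newBlock h
    s⇔a : ∀ i → Singleton F (next i) ⇔ Adjacent H i
    s⇔a = top₂-elim
      (begin
        Singleton F (next (fromℕ (suc m)))  ≡⟨ cong (Singleton F) (next-fromℕ (suc m)) ⟩
        Singleton F (inject₁ zero)          ≈⟨ neither (¬Singleton-joinBlock-inject₁ f zero) (fresh-∉ h zero ∘ sym) ⟩
        (fresh h ≡ h zero)                  ≡⟨ Adjacent-∷ʳ-last h (fresh h) ⟨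
        Adjacent H (fromℕ (suc m))          ∎)
      (begin
        Singleton F (next (inject₁ (fromℕ m)))  ≡⟨ cong (Singleton F) (next-inject₁ (fromℕ m)) ⟩
        Singleton F (fromℕ (suc m))             ≈⟨ neither (¬Singleton-joinBlock-last f zero) (fresh-∉ h (fromℕ m)) ⟩
        (h (fromℕ m) ≡ fresh h)                 ≡⟨ Adjacent-∷ʳ-penultimate h (fresh h) ⟨
        Adjacent H (inject₁ (fromℕ m))          ∎)
      (singleton⇔adjacent-inner f⇄h _ _ (λ k s e → 0≢1+n (sym (s zero e))))
    a⇔s : ∀ i → Adjacent F i ⇔ Singleton H i
    a⇔s = top₂-elim
      (begin
        Adjacent F (fromℕ (suc m))   ≡⟨ Adjacent-∷ʳ-last f (f zero) ⟩
        (f zero ≡ f zero)            ≈⟨ both refl (Singleton-newBlock-last h) ⟩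
        Singleton H (fromℕ (suc m))  ∎)
      (adjacent⇔singleton-inject₁ f⇄h _ _ (fromℕ m) (λ _ → fresh-∉ h (fromℕ m))
        (trans (Adjacent-∷ʳ-penultimate f (f zero)) (sym (Adjacent-fromℕ f))))
      (λ k → adjacent⇔singleton-inject₁ f⇄h _ _ (inject₁ k) (λ _ → fresh-∉ h (inject₁ k))
        (Adjacent-∷ʳ-inner f (f zero) k))

-- Pivots

Pivot : Labelling n → Fin n → Set
Pivot f i = Singleton f i ⊎ Adjacent f i

CoPivot : Labelling (suc n) → Fin (suc n) → Set
CoPivot g i = Adjacent g (prev i) ⊎ Singleton g i

Pivot? : (f : Labelling n) → Decidable (Pivot f)
Pivot? f i = Singleton? f i ⊎-dec Adjacent? f i

CoPivot? : (g : Labelling (suc n)) → Decidable (CoPivot g)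
CoPivot? g i = Adjacent? g (prev i) ⊎-dec Singleton? g i

Pivot-≈ : {f g : Labelling n} → f ≈ g → ∀ i → Pivot f i ⇔ Pivot g i
Pivot-≈ f≈g i = Singleton-≈ f≈g i ⊎-cong Adjacent-≈ f≈g i

CoPivot-≈ : {f g : Labelling (suc n)} → f ≈ g → ∀ i → CoPivot f i ⇔ CoPivot g i
CoPivot-≈ f≈g i = Adjacent-≈ f≈g (prev i) ⊎-cong Singleton-≈ f≈g i

Pivot⇔CoPivot : {f g : Labelling (suc n)} → f ⇄ g → ∀ i → Pivot f i ⇔ CoPivot g i
Pivot⇔CoPivot {f = f} {g} f⇄g i = singleton⇔adjacent′ ⊎-cong adjacent⇔singleton f⇄g i
  where
  open ⇔-Reasoning
  singleton⇔adjacent′ : Singleton f i ⇔ Adjacent g (prev i)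
  singleton⇔adjacent′ = begin
    Singleton f i               ≡⟨ cong (Singleton f) (next-prev i) ⟨
    Singleton f (next (prev i)) ≈⟨ singleton⇔adjacent f⇄g (prev i) ⟩
    Adjacent g (prev i)         ∎

⇄-self : {f : Labelling n} → (∀ i → ¬ Pivot f i) → f ⇄ f
⇄-self no-pivot = record
  { singleton⇔adjacent = λ i → neither (no-pivot (next i) ∘ inj₁) (no-pivot i ∘ inj₂)
  ; adjacent⇔singleton = λ i → neither (no-pivot i ∘ inj₂) (no-pivot i ∘ inj₁)
  }

¬CoPivot⇒¬Pivot : {g : Labelling (suc n)} → (∀ i → ¬ CoPivot g i) → ∀ i → ¬ Pivot g i
¬CoPivot⇒¬Pivot no-copivot i (inj₁ s) = no-copivot i (inj₂ s)
¬CoPivot⇒¬Pivot {g = g} no-copivot i (inj₂ a) = no-copivot (next i) (inj₁ (subst (Adjacent g) (sym (prev-next i)) a))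

Pivot-∘ : (ρ : CycleAutomorphism n) {f : Labelling n} → ∀ i → Pivot (f ∘ apply ρ) i ⇔ Pivot f (apply ρ i)
Pivot-∘ ρ {f} i = Singleton-∘ ρ f i ⊎-cong Adjacent-∘ ρ f i

CoPivot-∘ : (ρ : CycleAutomorphism (suc n)) {g : Labelling (suc n)} →
            ∀ i → CoPivot (g ∘ apply ρ) i ⇔ CoPivot g (apply ρ i)
CoPivot-∘ ρ {g} i = adjacent-prev ⊎-cong Singleton-∘ ρ g i
  where
  open ⇔-Reasoning
  adjacent-prev : Adjacent (g ∘ apply ρ) (prev i) ⇔ Adjacent g (prev (apply ρ i))
  adjacent-prev = begin
    Adjacent (g ∘ apply ρ) (prev i)  ≈⟨ Adjacent-∘ ρ g (prev i) ⟩
    Adjacent g (apply ρ (prev i))    ≡⟨ cong (Adjacent g) (apply-prev ρ i) ⟩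
    Adjacent g (prev (apply ρ i))    ∎

-- Deleting and reinserting the last element

module _ {m : ℕ} (g : Labelling (suc (suc m))) where

  head≡last : Adjacent g (fromℕ (suc m)) → g zero ≡ last g
  head≡last a = sym (trans a (cong g (next-fromℕ (suc m))))

  penultimate≡last : Adjacent g (inject₁ (fromℕ m)) → g (inject₁ (fromℕ m)) ≡ last g
  penultimate≡last a = trans a (cong g (next-inject₁ (fromℕ m)))

  adjacent-last⇒¬singleton : Adjacent g (fromℕ (suc m)) → ¬ Singleton g (fromℕ (suc m))
  adjacent-last⇒¬singleton a s = fromℕ≢inject₁ (s zero (sym (head≡last a)))

  singleton-last⇒¬adjacent : Singleton g (fromℕ (suc m)) → ¬ Adjacent g (inject₁ (fromℕ m))
  singleton-last⇒¬adjacent s a = fromℕ≢inject₁ (s (inject₁ (fromℕ m)) (sym (penultimate≡last a)))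

module _ {m : ℕ} (h : Labelling (suc m)) where

  Adjacent-joinBlock-penultimate : Adjacent (joinBlock h (fromℕ m)) (inject₁ (fromℕ m))
  Adjacent-joinBlock-penultimate =
    sym (trans (cong (joinBlock h (fromℕ m)) (next-inject₁ (fromℕ m))) (joinBlock-last h (fromℕ m)))

  ¬Adjacent-newBlock-penultimate : ¬ Adjacent (newBlock h) (inject₁ (fromℕ m))
  ¬Adjacent-newBlock-penultimate a = fresh-∉ h (fromℕ m) (subst id (Adjacent-∷ʳ-penultimate h (fresh h)) a)

module _ {m : ℕ} (rec : Labelling (suc m) → Labelling (suc m)) where

  exchangeStep : Labelling (suc (suc m)) → Labelling (suc (suc m))
  exchangeStep g with Singleton? g (fromℕ (suc m))
  ... | yes _ = joinBlock (rec (init g)) (fromℕ m)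
  ... | no _  = newBlock (rec (init g))

  exchange⁻¹Step : Labelling (suc (suc m)) → Labelling (suc (suc m))
  exchange⁻¹Step g with Adjacent? g (inject₁ (fromℕ m))
  ... | yes _ = newBlock (rec (init g))
  ... | no _  = joinBlock (rec (init g)) zero

  module _ (g : Labelling (suc (suc m))) where

    exchangeStep-singleton : Singleton g (fromℕ (suc m)) → exchangeStep g ≡ joinBlock (rec (init g)) (fromℕ m)
    exchangeStep-singleton s with Singleton? g (fromℕ (suc m))
    ... | yes _ = refl
    ... | no ¬s = ⊥-elim (¬s s)

    exchangeStep-¬singleton : ¬ Singleton g (fromℕ (suc m)) → exchangeStep g ≡ newBlock (rec (init g))
    exchangeStep-¬singleton ¬s with Singleton? g (fromℕ (suc m))
    ... | yes s = ⊥-elim (¬s s)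
    ... | no _  = refl

    exchange⁻¹Step-adjacent : Adjacent g (inject₁ (fromℕ m)) → exchange⁻¹Step g ≡ newBlock (rec (init g))
    exchange⁻¹Step-adjacent a with Adjacent? g (inject₁ (fromℕ m))
    ... | yes _ = refl
    ... | no ¬a = ⊥-elim (¬a a)

    exchange⁻¹Step-¬adjacent : ¬ Adjacent g (inject₁ (fromℕ m)) → exchange⁻¹Step g ≡ joinBlock (rec (init g)) zero
    exchange⁻¹Step-¬adjacent ¬a with Adjacent? g (inject₁ (fromℕ m))
    ... | yes a = ⊥-elim (¬a a)
    ... | no _  = refl

  exchangeStep-cong : Preserves-≈ rec → Preserves-≈ exchangeStep
  exchangeStep-cong rec-cong {g₁} {g₂} g₁≈g₂
    with Singleton? g₁ (fromℕ (suc m)) | Singleton? g₂ (fromℕ (suc m))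
  ... | yes _ | yes _ = joinBlock-cong (rec-cong (∘-≈ inject₁ g₁≈g₂)) (fromℕ m)
  ... | no _  | no _  = newBlock-cong (rec-cong (∘-≈ inject₁ g₁≈g₂))
  ... | yes s | no ¬s = ⊥-elim (¬s (to (Singleton-≈ g₁≈g₂ _) s))
  ... | no ¬s | yes s = ⊥-elim (¬s (from (Singleton-≈ g₁≈g₂ _) s))

  exchange⁻¹Step-cong : Preserves-≈ rec → Preserves-≈ exchange⁻¹Step
  exchange⁻¹Step-cong rec-cong {g₁} {g₂} g₁≈g₂
    with Adjacent? g₁ (inject₁ (fromℕ m)) | Adjacent? g₂ (inject₁ (fromℕ m))
  ... | yes _ | yes _ = newBlock-cong (rec-cong (∘-≈ inject₁ g₁≈g₂))
  ... | no _  | no _  = joinBlock-cong (rec-cong (∘-≈ inject₁ g₁≈g₂)) zero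
  ... | yes a | no ¬a = ⊥-elim (¬a (to (Adjacent-≈ g₁≈g₂ _) a))
  ... | no ¬a | yes a = ⊥-elim (¬a (from (Adjacent-≈ g₁≈g₂ _) a))

  ⇄-exchangeStep : (∀ f → f ⇄ rec f) → ∀ g → Pivot g (fromℕ (suc m)) → g ⇄ exchangeStep g
  ⇄-exchangeStep rec-⇄ g (inj₁ s) = subst (g ⇄_) (sym (exchangeStep-singleton g s))
    (⇄-≈ (≈-sym (≈-newBlock-init g s)) ≈-refl (newBlock⇄joinBlock (rec-⇄ (init g))))
  ⇄-exchangeStep rec-⇄ g (inj₂ a) = subst (g ⇄_) (sym (exchangeStep-¬singleton g (adjacent-last⇒¬singleton g a)))
    (⇄-≈ (≈-sym (≈-joinBlock-init g zero (head≡last g a))) ≈-refl (joinBlock⇄newBlock (rec-⇄ (init g))))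

  exchange⁻¹Step-⇄ : (∀ f → rec f ⇄ f) → ∀ g → CoPivot g (fromℕ (suc m)) → exchange⁻¹Step g ⇄ g
  exchange⁻¹Step-⇄ rec-⇄ g (inj₁ a) = subst (_⇄ g) (sym (exchange⁻¹Step-adjacent g a))
    (⇄-≈ ≈-refl (≈-sym (≈-joinBlock-init g (fromℕ m) (penultimate≡last g a))) (newBlock⇄joinBlock (rec-⇄ (init g))))
  exchange⁻¹Step-⇄ rec-⇄ g (inj₂ s) = subst (_⇄ g) (sym (exchange⁻¹Step-¬adjacent g (singleton-last⇒¬adjacent g s)))
    (⇄-≈ ≈-refl (≈-sym (≈-newBlock-init g s)) (joinBlock⇄newBlock (rec-⇄ (init g))))

module _ {m : ℕ} {rec rec′ : Labelling (suc m) → Labelling (suc m)}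
         (rec′-cong : Preserves-≈ rec′) (rec′∘rec : ∀ f → rec′ (rec f) ≈ f) where
  open ≈-Reasoning

  rec′-init-∷ʳ : ∀ g (v : ℕ) → rec′ (init (rec (init g) ∷ʳ v)) ≈ init g
  rec′-init-∷ʳ g v = ≈-trans (rec′-cong (init-∷ʳ (rec (init g)) v)) (rec′∘rec (init g))

  exchange⁻¹Step∘exchangeStep : ∀ g → Pivot g (fromℕ (suc m)) → exchange⁻¹Step rec′ (exchangeStep rec g) ≈ g
  exchange⁻¹Step∘exchangeStep g (inj₁ s) =
    let h = rec (init g) in begin
    exchange⁻¹Step rec′ (exchangeStep rec g)
      ≡⟨ cong (exchange⁻¹Step rec′) (exchangeStep-singleton rec g s) ⟩
    exchange⁻¹Step rec′ (joinBlock h (fromℕ m))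
      ≡⟨ exchange⁻¹Step-adjacent rec′ (joinBlock h (fromℕ m)) (Adjacent-joinBlock-penultimate h) ⟩
    newBlock (rec′ (init (joinBlock h (fromℕ m))))  ≈⟨ newBlock-cong (rec′-init-∷ʳ g (h (fromℕ m))) ⟩
    newBlock (init g)                               ≈⟨ ≈-newBlock-init g s ⟨
    g                                               ∎
  exchange⁻¹Step∘exchangeStep g (inj₂ a) =
    let h = rec (init g) in begin
    exchange⁻¹Step rec′ (exchangeStep rec g)
      ≡⟨ cong (exchange⁻¹Step rec′) (exchangeStep-¬singleton rec g (adjacent-last⇒¬singleton g a)) ⟩
    exchange⁻¹Step rec′ (newBlock h)
      ≡⟨ exchange⁻¹Step-¬adjacent rec′ (newBlock h) (¬Adjacent-newBlock-penultimate h) ⟩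
    joinBlock (rec′ (init (newBlock h))) zero  ≈⟨ joinBlock-cong (rec′-init-∷ʳ g (fresh h)) zero ⟩
    joinBlock (init g) zero                    ≈⟨ ≈-joinBlock-init g zero (head≡last g a) ⟨
    g                                          ∎

module _ {m : ℕ} {rec rec′ : Labelling (suc m) → Labelling (suc m)}
         (rec-cong : Preserves-≈ rec) (rec∘rec′ : ∀ f → rec (rec′ f) ≈ f) where
  open ≈-Reasoning

  rec-init-∷ʳ : ∀ g (v : ℕ) → rec (init (rec′ (init g) ∷ʳ v)) ≈ init g
  rec-init-∷ʳ g v = ≈-trans (rec-cong (init-∷ʳ (rec′ (init g)) v)) (rec∘rec′ (init g))

  exchangeStep∘exchange⁻¹Step : ∀ g → CoPivot g (fromℕ (suc m)) → exchangeStep rec (exchange⁻¹Step rec′ g) ≈ g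
  exchangeStep∘exchange⁻¹Step g (inj₁ a) =
    let h = rec′ (init g) in begin
    exchangeStep rec (exchange⁻¹Step rec′ g)
      ≡⟨ cong (exchangeStep rec) (exchange⁻¹Step-adjacent rec′ g a) ⟩
    exchangeStep rec (newBlock h)
      ≡⟨ exchangeStep-singleton rec (newBlock h) (Singleton-newBlock-last h) ⟩
    joinBlock (rec (init (newBlock h))) (fromℕ m)  ≈⟨ joinBlock-cong (rec-init-∷ʳ g (fresh h)) (fromℕ m) ⟩
    joinBlock (init g) (fromℕ m)                   ≈⟨ ≈-joinBlock-init g (fromℕ m) (penultimate≡last g a) ⟨
    g                                              ∎
  exchangeStep∘exchange⁻¹Step g (inj₂ s) =
    let h = rec′ (init g) in begin
    exchangeStep rec (exchange⁻¹Step rec′ g)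
      ≡⟨ cong (exchangeStep rec) (exchange⁻¹Step-¬adjacent rec′ g (singleton-last⇒¬adjacent g s)) ⟩
    exchangeStep rec (joinBlock h zero)
      ≡⟨ exchangeStep-¬singleton rec (joinBlock h zero) (¬Singleton-joinBlock-last h zero) ⟩
    newBlock (rec (init (joinBlock h zero)))  ≈⟨ newBlock-cong (rec-init-∷ʳ g (h zero)) ⟩
    newBlock (init g)                         ≈⟨ ≈-newBlock-init g s ⟨
    g                                         ∎

-- Moving a pivot to the last position

module _ {k : ℕ} where

  rotated unrotated : Fin (suc k) → Labelling (suc k) → Labelling (suc k)
  rotated   i f = f ∘ apply (rotationTo i)
  unrotated i f = f ∘ unapply (rotationTo i)

  unrotated-rotated : ∀ i (f : Labelling (suc k)) → unrotated i (rotated i f) ≈ f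
  unrotated-rotated i f = ≗⇒≈ (cong f ∘ apply-unapply (rotationTo i))

  Pivot-rotated : ∀ {f} i → Pivot f i → Pivot (rotated i f) (fromℕ k)
  Pivot-rotated {f} i pivot =
    from (Pivot-∘ (rotationTo i) (fromℕ k)) (subst (Pivot f) (sym (rotationTo-fromℕ i)) pivot)

  CoPivot-rotated : ∀ {g} i → CoPivot g i → CoPivot (rotated i g) (fromℕ k)
  CoPivot-rotated {g} i copivot =
    from (CoPivot-∘ (rotationTo i) (fromℕ k)) (subst (CoPivot g) (sym (rotationTo-fromℕ i)) copivot)

  stepAt : Maybe (Fin (suc k)) → (Labelling (suc k) → Labelling (suc k)) → Labelling (suc k) → Labelling (suc k)
  stepAt nothing  step f = f
  stepAt (just i) step f = unrotated i (step (rotated i f))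

  module _ {step : Labelling (suc k) → Labelling (suc k)} where

    stepAt-cong : Preserves-≈ step → ∀ r → Preserves-≈ (stepAt r step)
    stepAt-cong step-cong nothing  f≈g = f≈g
    stepAt-cong step-cong (just i) f≈g = ∘-≈ _ (step-cong (∘-≈ _ f≈g))

    ⇄-stepAt-first : ∀ f → (∀ i → Pivot f i → rotated i f ⇄ step (rotated i f)) →
                      f ⇄ stepAt (first (Pivot? f)) step f
    ⇄-stepAt-first f step-⇄ with first (Pivot? f) in eq
    ... | nothing = ⇄-self (first-nothing (Pivot? f) eq)
    ... | just i  = ⇄-≈ (unrotated-rotated i f) ≈-refl
                        (⇄-∘ (inverse (rotationTo i)) (step-⇄ i (first-just (Pivot? f) eq)))

    stepAt-first-⇄ : ∀ g → (∀ i → CoPivot g i → step (rotated i g) ⇄ rotated i g) →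
                      stepAt (first (CoPivot? g)) step g ⇄ g
    stepAt-first-⇄ g step-⇄ with first (CoPivot? g) in eq
    ... | nothing = ⇄-self (¬CoPivot⇒¬Pivot (first-nothing (CoPivot? g) eq))
    ... | just i  = ⇄-≈ ≈-refl (unrotated-rotated i g)
                        (⇄-∘ (inverse (rotationTo i)) (step-⇄ i (first-just (CoPivot? g) eq)))

    stepAt-inverse : ∀ {step′} → Preserves-≈ step′ → ∀ r f →
      (∀ i → r ≡ just i → step′ (step (rotated i f)) ≈ rotated i f) → stepAt r step′ (stepAt r step f) ≈ f
    stepAt-inverse step′-cong nothing  f inv = ≈-refl
    stepAt-inverse step′-cong (just i) f inv = ≈-trans
      (∘-≈ _ (step′-cong (≗⇒≈ (cong (step (rotated i f)) ∘ unapply-apply (rotationTo i)))))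
      (≈-trans (∘-≈ _ (inv i refl)) (unrotated-rotated i f))

-- The bijection

exchange exchange⁻¹ : ∀ n → Labelling n → Labelling n
exchange zero          f = f
exchange (suc zero)    f = f
exchange (suc (suc m)) f = stepAt (first (Pivot? f)) (exchangeStep (exchange (suc m))) f
exchange⁻¹ zero          g = g
exchange⁻¹ (suc zero)    g = g
exchange⁻¹ (suc (suc m)) g = stepAt (first (CoPivot? g)) (exchange⁻¹Step (exchange⁻¹ (suc m))) g

module _ (m : ℕ) where

  exchange-unfold : ∀ f → exchange (suc (suc m)) f ≡ stepAt (first (Pivot? f)) (exchangeStep (exchange (suc m))) f
  exchange-unfold f = refl

  exchange⁻¹-unfold : ∀ g →
    exchange⁻¹ (suc (suc m)) g ≡ stepAt (first (CoPivot? g)) (exchange⁻¹Step (exchange⁻¹ (suc m))) g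
  exchange⁻¹-unfold g = refl

exchange-cong : ∀ n → Preserves-≈ (exchange n)
exchange-cong zero          f≈g = f≈g
exchange-cong (suc zero)    f≈g = f≈g
exchange-cong (suc (suc m)) {f} {g} f≈g = begin
  exchange (suc (suc m)) f                           ≡⟨ exchange-unfold m f ⟩
  stepAt (first (Pivot? f)) (exchangeStep (exchange (suc m))) f
    ≈⟨ stepAt-cong (exchangeStep-cong (exchange (suc m)) (exchange-cong (suc m))) (first (Pivot? f)) f≈g ⟩
  stepAt (first (Pivot? f)) (exchangeStep (exchange (suc m))) g
    ≡⟨ cong (λ r → stepAt r (exchangeStep (exchange (suc m))) g)
            (first-cong (Pivot? f) (Pivot? g) (Pivot-≈ f≈g)) ⟩
  stepAt (first (Pivot? g)) (exchangeStep (exchange (suc m))) g  ≡⟨ exchange-unfold m g ⟨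
  exchange (suc (suc m)) g                           ∎
  where open ≈-Reasoning

exchange⁻¹-cong : ∀ n → Preserves-≈ (exchange⁻¹ n)
exchange⁻¹-cong zero          f≈g = f≈g
exchange⁻¹-cong (suc zero)    f≈g = f≈g
exchange⁻¹-cong (suc (suc m)) {f} {g} f≈g = begin
  exchange⁻¹ (suc (suc m)) f                         ≡⟨ exchange⁻¹-unfold m f ⟩
  stepAt (first (CoPivot? f)) (exchange⁻¹Step (exchange⁻¹ (suc m))) f
    ≈⟨ stepAt-cong (exchange⁻¹Step-cong (exchange⁻¹ (suc m)) (exchange⁻¹-cong (suc m))) (first (CoPivot? f)) f≈g ⟩
  stepAt (first (CoPivot? f)) (exchange⁻¹Step (exchange⁻¹ (suc m))) g
    ≡⟨ cong (λ r → stepAt r (exchange⁻¹Step (exchange⁻¹ (suc m))) g)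
            (first-cong (CoPivot? f) (CoPivot? g) (CoPivot-≈ f≈g)) ⟩
  stepAt (first (CoPivot? g)) (exchange⁻¹Step (exchange⁻¹ (suc m))) g  ≡⟨ exchange⁻¹-unfold m g ⟨
  exchange⁻¹ (suc (suc m)) g                         ∎
  where open ≈-Reasoning

⇄-self₁ : (f : Labelling 1) → f ⇄ f
⇄-self₁ f = record { singleton⇔adjacent = λ { zero → both singleton refl }
                   ; adjacent⇔singleton = λ { zero → both refl singleton } }
  where
  singleton : Singleton f zero
  singleton zero _ = refl

⇄-exchange : ∀ n (f : Labelling n) → f ⇄ exchange n f
⇄-exchange zero          f = ⇄-self (λ ())
⇄-exchange (suc zero)    f = ⇄-self₁ f
⇄-exchange (suc (suc m)) f = ⇄-stepAt-first f
  (λ i pivot → ⇄-exchangeStep _ (⇄-exchange (suc m)) _ (Pivot-rotated i pivot))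

exchange⁻¹-⇄ : ∀ n (g : Labelling n) → exchange⁻¹ n g ⇄ g
exchange⁻¹-⇄ zero          g = ⇄-self (λ ())
exchange⁻¹-⇄ (suc zero)    g = ⇄-self₁ g
exchange⁻¹-⇄ (suc (suc m)) g = stepAt-first-⇄ g
  (λ i copivot → exchange⁻¹Step-⇄ _ (exchange⁻¹-⇄ (suc m)) _ (CoPivot-rotated i copivot))

exchange⁻¹∘exchange : ∀ n (f : Labelling n) → exchange⁻¹ n (exchange n f) ≈ f
exchange⁻¹∘exchange zero          f = ≈-refl
exchange⁻¹∘exchange (suc zero)    f = ≈-refl
exchange⁻¹∘exchange (suc (suc m)) f =
  let step = exchangeStep (exchange (suc m))
      step⁻¹ = exchange⁻¹Step (exchange⁻¹ (suc m))
  in begin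
  exchange⁻¹ (suc (suc m)) (exchange (suc (suc m)) f)
    ≡⟨ exchange⁻¹-unfold m (exchange (suc (suc m)) f) ⟩
  stepAt (first (CoPivot? (exchange (suc (suc m)) f))) step⁻¹ (exchange (suc (suc m)) f)
    ≡⟨ cong (λ r → stepAt r step⁻¹ (exchange (suc (suc m)) f)) same-pivot ⟨
  stepAt (first (Pivot? f)) step⁻¹ (exchange (suc (suc m)) f)
    ≡⟨ cong (stepAt (first (Pivot? f)) step⁻¹) (exchange-unfold m f) ⟩
  stepAt (first (Pivot? f)) step⁻¹ (stepAt (first (Pivot? f)) step f)
    ≈⟨ stepAt-inverse (exchange⁻¹Step-cong (exchange⁻¹ (suc m)) (exchange⁻¹-cong (suc m))) (first (Pivot? f)) f
         (λ i eq → exchange⁻¹Step∘exchangeStep (exchange⁻¹-cong (suc m)) (exchange⁻¹∘exchange (suc m)) (rotated i f)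
                     (Pivot-rotated i (first-just (Pivot? f) eq))) ⟩
  f ∎
  where
  open ≈-Reasoning
  same-pivot : first (Pivot? f) ≡ first (CoPivot? (exchange (suc (suc m)) f))
  same-pivot = first-cong (Pivot? f) (CoPivot? (exchange (suc (suc m)) f)) (Pivot⇔CoPivot (⇄-exchange (suc (suc m)) f))

exchange∘exchange⁻¹ : ∀ n (g : Labelling n) → exchange n (exchange⁻¹ n g) ≈ g
exchange∘exchange⁻¹ zero          g = ≈-refl
exchange∘exchange⁻¹ (suc zero)    g = ≈-refl
exchange∘exchange⁻¹ (suc (suc m)) g =
  let step = exchangeStep (exchange (suc m))
      step⁻¹ = exchange⁻¹Step (exchange⁻¹ (suc m))
  in begin
  exchange (suc (suc m)) (exchange⁻¹ (suc (suc m)) g)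
    ≡⟨ exchange-unfold m (exchange⁻¹ (suc (suc m)) g) ⟩
  stepAt (first (Pivot? (exchange⁻¹ (suc (suc m)) g))) step (exchange⁻¹ (suc (suc m)) g)
    ≡⟨ cong (λ r → stepAt r step (exchange⁻¹ (suc (suc m)) g)) same-pivot ⟩
  stepAt (first (CoPivot? g)) step (exchange⁻¹ (suc (suc m)) g)
    ≡⟨ cong (stepAt (first (CoPivot? g)) step) (exchange⁻¹-unfold m g) ⟩
  stepAt (first (CoPivot? g)) step (stepAt (first (CoPivot? g)) step⁻¹ g)
    ≈⟨ stepAt-inverse (exchangeStep-cong (exchange (suc m)) (exchange-cong (suc m))) (first (CoPivot? g)) g
         (λ i eq → exchangeStep∘exchange⁻¹Step (exchange-cong (suc m)) (exchange∘exchange⁻¹ (suc m)) (rotated i g)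
                     (CoPivot-rotated i (first-just (CoPivot? g) eq))) ⟩
  g ∎
  where
  open ≈-Reasoning
  same-pivot : first (Pivot? (exchange⁻¹ (suc (suc m)) g)) ≡ first (CoPivot? g)
  same-pivot = first-cong (Pivot? (exchange⁻¹ (suc (suc m)) g)) (CoPivot? g)
                          (Pivot⇔CoPivot (exchange⁻¹-⇄ (suc (suc m)) g))

-- Counting, and transfer to partitions

count-cong : {P Q : Pred A 0ℓ} (P? : Decidable P) (Q? : Decidable Q) → (∀ x → P x ⇔ Q x) →
             ∀ xs → length (filter P? xs) ≡ length (filter Q? xs)
count-cong P? Q? P⇔Q xs = cong length (filter-≐ P? Q? ((λ {x} → to (P⇔Q x)) , (λ {x} → from (P⇔Q x))) xs)

count-∘ : {P : Pred B 0ℓ} (P? : Decidable P) (g : A → B) →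
          ∀ xs → length (filter (P? ∘ g) xs) ≡ length (filter P? (map g xs))
count-∘ P? g [] = refl
count-∘ P? g (x ∷ xs) with does (P? (g x))
... | true  = cong suc (count-∘ P? g xs)
... | false = count-∘ P? g xs

tabulate-∷ʳ : (f : Fin (suc n) → A) → tabulate f ≡ tabulate (f ∘ inject₁) List.∷ʳ f (fromℕ n)
tabulate-∷ʳ {n = zero}  f = refl
tabulate-∷ʳ {n = suc n} f = cong (f zero ∷_) (tabulate-∷ʳ (f ∘ suc))

map-next-allFin : ∀ n → map next (allFin n) ↭ allFin n
map-next-allFin zero    = ↭-refl
map-next-allFin (suc m) = ↭-trans (↭-reflexive (begin
  map next (tabulate id)                            ≡⟨ map-tabulate id next ⟩
  tabulate next                                     ≡⟨ tabulate-∷ʳ next ⟩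
  tabulate (next ∘ inject₁) List.∷ʳ next (fromℕ m)  ≡⟨ cong₂ List._∷ʳ_ (tabulate-cong next-inject₁) (next-fromℕ m) ⟩
  tabulate suc List.∷ʳ zero                         ∎))
  (↭-sym (∷↭∷ʳ zero (tabulate suc)))
  where open ≡-Reasoning

count-next : {P : Pred (Fin n) 0ℓ} (P? : Decidable P) →
             length (filter (P? ∘ next) (allFin n)) ≡ length (filter P? (allFin n))
count-next {n = n} P? =
  trans (count-∘ P? next (allFin n)) (↭-length (filter-↭ P? (map-next-allFin n)))

encode : Partition n → Labelling n
encode π = toℕ ∘ label π

encode-≈ : (π : Partition n) → encode π ≈ label π
encode-≈ π = injective-≈ toℕ-injective (label π)

leastInBlock : Labelling n → Fin n → Fin n
leastInBlock f i = fromMaybe i (first (λ j → f j ≟ℕ f i))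

first-leastInBlock : (f : Labelling n) (i : Fin n) → first (λ j → f j ≟ℕ f i) ≡ just (leastInBlock f i)
first-leastInBlock f i with first (λ j → f j ≟ℕ f i) in eq
... | just _  = refl
... | nothing = ⊥-elim (first-nothing (λ j → f j ≟ℕ f i) eq i refl)

decode : Labelling n → Partition n
decode f = mkPartition (leastInBlock f)

label-decode : (f : Labelling n) → label (decode f) ≈ f
label-decode f i j = mk⇔
  (λ e → trans (sym (least-in-block i)) (trans (cong f e) (least-in-block j)))
  (λ e → just-injective (trans (sym (first-leastInBlock f i))
                               (trans (cong (λ v → first (λ k → f k ≟ℕ v)) e) (first-leastInBlock f j))))
  where
  least-in-block : ∀ i → f (leastInBlock f i) ≡ f i
  least-in-block i = first-just (λ j → f j ≟ℕ f i) (first-leastInBlock f i)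

onPartitions : (Labelling n → Labelling n) → Partition n → Partition n
onPartitions F π = decode (F (encode π))

module _ {F : Labelling n → Labelling n} where

  onPartitions-cong : Preserves-≈ F → ∀ π σ → π ≈P σ → onPartitions F π ≈P onPartitions F σ
  onPartitions-cong F-cong π σ π≈σ = ≈-trans (label-decode _)
    (≈-trans (F-cong (≈-trans (encode-≈ π) (≈-trans π≈σ (≈-sym (encode-≈ σ))))) (≈-sym (label-decode _)))

  onPartitions-inverse : {G : Labelling n → Labelling n} → Preserves-≈ G → (∀ f → G (F f) ≈ f) →
                         ∀ π → onPartitions G (onPartitions F π) ≈P π
  onPartitions-inverse G-cong G∘F π = ≈-trans (label-decode _)
    (≈-trans (G-cong (≈-trans (encode-≈ (onPartitions F π)) (label-decode _)))
    (≈-trans (G∘F (encode π)) (encode-≈ π)))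

  module _ (F-⇄ : ∀ f → f ⇄ F f) (π : Partition n) where
    open ⇔-Reasoning

    singletons-onPartitions : singletons (onPartitions F π) ≡ adjacencies π
    singletons-onPartitions = count-cong _ _ singleton⇔adjacent′ (allFin n)
      where
      singleton⇔adjacent′ : ∀ i → IsSingleton (onPartitions F π) i ⇔ SameBlock π i (next i)
      singleton⇔adjacent′ i = begin
        Singleton (label (onPartitions F π)) i  ≈⟨ Singleton-≈ (label-decode _) i ⟩
        Singleton (F (encode π)) i              ≈⟨ adjacent⇔singleton (F-⇄ (encode π)) i ⟨
        Adjacent (encode π) i                   ≈⟨ Adjacent-≈ (encode-≈ π) i ⟩
        Adjacent (label π) i                    ∎

    adjacencies-onPartitions : adjacencies (onPartitions F π) ≡ singletons π
    adjacencies-onPartitions =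
      trans (count-cong _ _ adjacent⇔singleton′ (allFin n)) (count-next (isSingleton? π))
      where
      adjacent⇔singleton′ : ∀ i → SameBlock (onPartitions F π) i (next i) ⇔ IsSingleton π (next i)
      adjacent⇔singleton′ i = begin
        Adjacent (label (onPartitions F π)) i  ≈⟨ Adjacent-≈ (label-decode _) i ⟩
        Adjacent (F (encode π)) i              ≈⟨ singleton⇔adjacent (F-⇄ (encode π)) i ⟨
        Singleton (encode π) (next i)          ≈⟨ Singleton-≈ (encode-≈ π) (next i) ⟩
        Singleton (label π) (next i)           ∎

-- The construction also covers n = 0.
theorem1 : (n : ℕ) → 0 < n →
    Σ (Partition n → Partition n) λ φ →
    Σ (Partition n → Partition n) λ ψ →
      (∀ π σ → π ≈P σ → φ π ≈P φ σ) ×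
      (∀ π σ → π ≈P σ → ψ π ≈P ψ σ) ×
      (∀ π → ψ (φ π) ≈P π) ×
      (∀ π → φ (ψ π) ≈P π) ×
      (∀ π → singletons (φ π) ≡ adjacencies π) ×
      (∀ π → adjacencies (φ π) ≡ singletons π)
theorem1 n _ =
  onPartitions (exchange n) , onPartitions (exchange⁻¹ n) ,
  onPartitions-cong (exchange-cong n) ,
  onPartitions-cong (exchange⁻¹-cong n) ,
  onPartitions-inverse (exchange⁻¹-cong n) (exchange⁻¹∘exchange n) ,
  onPartitions-inverse (exchange-cong n) (exchange∘exchange⁻¹ n) ,
  singletons-onPartitions (⇄-exchange n) ,
  adjacencies-onPartitions (⇄-exchange n)
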